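{- Let $n$ be an odd perfect number, written in the form $n=\pi^\alpha M^2$, where $\pi$ is prime, $\alpha$ and $M$ are positive integers, $\gcd(\pi,M)=1$ and $\pi\equiv\alpha\equiv 1\pmod 4$. Then $$\bigl(n\equiv 9\pmod{36}\bigr)\ \text{ or }\ \bigl(n\equiv \pi\equiv 1\pmod{12}\bigr).$$
   Context: A positive integer $n$ is perfect if $\sigma(n)=2n$, where $\sigma(n)$ is the sum of the positive divisors of $n$. By Euler's theorem every odd perfect number $n$ has such a representation $n=\pi^\alpha M^2$; $\pi$ is the unique prime dividing $n$ to an odd power and $\alpha$ is its exponent. The condition "$n\equiv\pi\equiv 1\pmod{12}$" means that both $n\equiv 1\pmod{12}$ and $\pi\equiv 1\pmod{12}$. -}

module Defs where

open import Data.Nat using (ℕ; zero; suc; _+_; _*_; _<_)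
open import Data.Nat.Divisibility using (_∣?_)
open import Data.List using (List; filter)
open import Data.Nat.ListAction using (sum)
open import Data.List.Base using (upTo; map)
open import Data.Product using (_×_)
open import Relation.Binary.PropositionalEquality using (_≡_)

divisors : ℕ → List ℕ
divisors n = filter (_∣? n) (map suc (upTo n))

σ : ℕ → ℕ
σ n = sum (divisors n)

Perfect : ℕ → Set
Perfect n = (0 < n) × (σ n ≡ 2 * n)

{-# OPTIONS --safe #-}
-- Pairing each divisor d of n with n / d gives 2σ(n) = Σ (d + n/d); if n ≡ 2 (mod 3) then
-- every pair satisfies d · (n/d) ≡ 2, hence d + n/d ≡ 0 (mod 3), so 3 divides 2σ(n) = 4n,
-- which is absurd.  Thus a perfect n is ≡ 0 or 1 (mod 3).  For n = π^α M² with π ≡ 1 (mod 4)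
-- and M odd, n ≡ 1 (mod 4).  Since π ≢ 0 (mod 3) (π ≠ 3) and α is odd, π^α ≡ π (mod 3).  If
-- 3 ∣ n then 3 ∣ M (as 3 ∤ π), so 9 ∣ n and n ≡ 9 (mod 36); otherwise M² ≡ 1, so n ≡ π ≡ 1 (mod 3) and
-- both are ≡ 1 (mod 12).
module Submission where

open import Defs
open import Data.List using ([]; _∷_; map; upTo)
open import Data.List.Membership.Propositional using (_∈_)
open import Data.List.Membership.Propositional.Properties
  using (∈-filter⁺; ∈-filter⁻; ∈-map⁺; ∈-map⁻; ∈-upTo⁺)
open import Data.List.Membership.Propositional.Properties.WithK using (unique∧set⇒bag)
open import Data.List.Properties using (map-id; map-∘; map-id-local)
open import Data.List.Relation.Binary.BagAndSetEquality using (∼bag⇒↭)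
open import Data.List.Relation.Unary.All as All using (All; []; _∷_)
import Data.List.Relation.Unary.All.Properties as All
import Data.List.Relation.Unary.AllPairs as AllPairs
import Data.List.Relation.Unary.AllPairs.Properties as AllPairs
open import Data.List.Relation.Unary.Unique.Propositional using (Unique)
import Data.List.Relation.Unary.Unique.Propositional.Properties as Unique
open import Data.Nat
open import Data.Nat.DivMod
open import Data.Nat.Divisibility
open import Data.Nat.GCD using (gcd)
open import Data.Nat.ListAction using (sum)
open import Data.Nat.ListAction.Properties using (sum-↭)
open import Data.Nat.Primality using (Prime; prime⇒irreducible; euclidsLemma; prime?; ¬prime[1])
open import Data.Nat.Properties
open import Algebra.Properties.CommutativeSemigroup +-commutativeSemigroup using (interchange)
open import Data.Product using (_×_; _,_; proj₂)
open import Data.Sum using (_⊎_; inj₁; inj₂)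
open import Function using (_∘_)
open import Function.Bundles using (_⇔_; mk⇔)
open import Relation.Binary.PropositionalEquality
open import Relation.Nullary using (¬_; contradiction)
open import Relation.Nullary.Decidable using (True; toWitness; ¬?; _→-dec_; _⊎-dec_)
open import Relation.Unary using (Decidable)

private
  variable
    a d n : ℕ

-- The value at d = 0 is junk: 0 divides no positive n.
codivisor : ℕ → ℕ → ℕ
codivisor n zero        = 0
codivisor n d@(suc _)   = n / d

*-codivisor : d ∣ n → d * codivisor n d ≡ n
*-codivisor {zero}  (divides-refl q) = sym (*-zeroʳ q)
*-codivisor {suc _} d∣n              = m*[n/m]≡n d∣n

codivisor-∣ : d ∣ n → codivisor n d ∣ n
codivisor-∣ {d} d∣n = divides d (sym (*-codivisor d∣n))

codivisor-involutive : .{{NonZero n}} → d ∣ n → codivisor n (codivisor n d) ≡ d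
codivisor-involutive {n} {d} d∣n with codivisor n d | *-codivisor d∣n
... | zero  | d*0≡n = contradiction (trans (sym d*0≡n) (*-zeroʳ d)) (≢-nonZero⁻¹ n)
... | suc k | refl  = m*n/n≡m d (suc k)

∈-divisors⁻ : d ∈ divisors n → d ∣ n
∈-divisors⁻ {n = n} d∈ = proj₂ (∈-filter⁻ (_∣? n) {xs = map suc (upTo n)} d∈)

∈-divisors⁺ : .{{NonZero n}} → d ∣ n → d ∈ divisors n
∈-divisors⁺ {n} {zero}  0∣n = contradiction (0∣⇒≡0 0∣n) (≢-nonZero⁻¹ n)
∈-divisors⁺ {n} {suc _} d∣n = ∈-filter⁺ (_∣? n) (∈-map⁺ suc (∈-upTo⁺ (∣⇒≤ d∣n))) d∣n

divisors-unique : ∀ n → Unique (divisors n)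
divisors-unique n = Unique.filter⁺ (_∣? n) (Unique.map⁺ suc-injective (Unique.upTo⁺ n))

map-codivisor-involutive : .{{NonZero n}} → map (codivisor n) (map (codivisor n) (divisors n)) ≡ divisors n
map-codivisor-involutive {n} = trans (sym (map-∘ (divisors n)))
  (map-id-local (All.tabulate (codivisor-involutive ∘ ∈-divisors⁻)))

codivisors-unique : .{{NonZero n}} → Unique (map (codivisor n) (divisors n))
codivisors-unique {n} = AllPairs.map (λ c≢c′ c≡c′ → c≢c′ (cong (codivisor n) c≡c′))
  (AllPairs.map⁻ (subst Unique (sym map-codivisor-involutive) (divisors-unique n)))

∈-divisors⇔∈-codivisors : .{{NonZero n}} → ∀ {d} → d ∈ divisors n ⇔ d ∈ map (codivisor n) (divisors n)
∈-divisors⇔∈-codivisors {n} = mk⇔ to from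
  where
  to : d ∈ divisors n → d ∈ map (codivisor n) (divisors n)
  to {d} d∈ = subst (_∈ _) (codivisor-involutive (∈-divisors⁻ d∈))
    (∈-map⁺ (codivisor n) (∈-divisors⁺ (codivisor-∣ (∈-divisors⁻ d∈))))
  from : d ∈ map (codivisor n) (divisors n) → d ∈ divisors n
  from d∈ with _ , e∈ , refl ← ∈-map⁻ (codivisor n) d∈ = ∈-divisors⁺ (codivisor-∣ (∈-divisors⁻ e∈))

sum-codivisors : ∀ n .{{_ : NonZero n}} → sum (map (codivisor n) (divisors n)) ≡ σ n
sum-codivisors n = sym (sum-↭ (∼bag⇒↭
  (unique∧set⇒bag (divisors-unique n) codivisors-unique ∈-divisors⇔∈-codivisors)))

sum-map-+ : ∀ {A : Set} (f g : A → ℕ) xs →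
            sum (map (λ x → f x + g x) xs) ≡ sum (map f xs) + sum (map g xs)
sum-map-+ f g []       = refl
sum-map-+ f g (x ∷ xs) = trans (cong (f x + g x +_) (sum-map-+ f g xs)) (interchange (f x) (g x) _ _)

∣-sum : ∀ {xs} → All (d ∣_) xs → d ∣ sum xs
∣-sum []           = divides 0 refl
∣-sum (d∣x ∷ d∣xs) = ∣m∣n⇒∣m+n d∣x (∣-sum d∣xs)

sum-divisor-pairs : ∀ n .{{_ : NonZero n}} → sum (map (λ d → d + codivisor n d) (divisors n)) ≡ σ n + σ n
sum-divisor-pairs n = begin
  sum (map (λ d → d + codivisor n d) (divisors n))
    ≡⟨ sum-map-+ (λ d → d) (codivisor n) (divisors n) ⟩
  sum (map (λ d → d) (divisors n)) + sum (map (codivisor n) (divisors n))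
    ≡⟨ cong₂ _+_ (cong sum (map-id (divisors n))) (sum-codivisors n) ⟩
  σ n + σ n ∎
  where open ≡-Reasoning

∀-residue : ∀ {P : ℕ → Set} (P? : Decidable P) m .{{_ : NonZero m}} →
            {True (allUpTo? P? m)} → ∀ a → P (a % m)
∀-residue P? m {P<m} a = toWitness P<m (m%n<n a m)

%-distribˡ-^ : ∀ a k m .{{_ : NonZero m}} → (a ^ k) % m ≡ ((a % m) ^ k) % m
%-distribˡ-^ a zero    m = refl
%-distribˡ-^ a (suc k) m = begin
  (a * a ^ k) % m                     ≡⟨ %-distribˡ-* a (a ^ k) m ⟩
  (a % m * (a ^ k % m)) % m           ≡⟨ cong₂ (λ x y → (x * y) % m) (sym (m%n%n≡m%n a m)) (%-distribˡ-^ a k m) ⟩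
  (a % m % m * ((a % m) ^ k % m)) % m ≡⟨ sym (%-distribˡ-* (a % m) ((a % m) ^ k) m) ⟩
  (a % m * (a % m) ^ k) % m           ∎
  where open ≡-Reasoning

n%o≡1⇒[m*n]%o≡m%o : ∀ m n o .{{_ : NonZero o}} → n % o ≡ 1 → (m * n) % o ≡ m % o
n%o≡1⇒[m*n]%o≡m%o m n o n%o≡1 = begin
  (m * n) % o           ≡⟨ %-distribˡ-* m n o ⟩
  (m % o * (n % o)) % o ≡⟨ cong (λ x → (m % o * x) % o) n%o≡1 ⟩
  (m % o * 1) % o       ≡⟨ cong (_% o) (*-identityʳ (m % o)) ⟩
  m % o % o             ≡⟨ m%n%n≡m%n m o ⟩
  m % o                 ∎
  where open ≡-Reasoning

m%o≡1⇒m^n%o≡1 : ∀ m n o .{{_ : NonZero o}} → m % o ≡ 1 → (m ^ n) % o ≡ 1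
m%o≡1⇒m^n%o≡1 m n o m%o≡1 = begin
  (m ^ n) % o         ≡⟨ %-distribˡ-^ m n o ⟩
  ((m % o) ^ n) % o   ≡⟨ cong (λ x → (x ^ n) % o) m%o≡1 ⟩
  (1 ^ n) % o         ≡⟨ cong (_% o) (^-zeroˡ n) ⟩
  1 % o               ≡⟨ cong (_% o) m%o≡1 ⟨
  m % o % o           ≡⟨ m%n%n≡m%n m o ⟩
  m % o               ≡⟨ m%o≡1 ⟩
  1                   ∎
  where open ≡-Reasoning

%3-cases : ∀ a → a % 3 ≡ 0 ⊎ a % 3 ≡ 1 ⊎ a % 3 ≡ 2
%3-cases = ∀-residue (λ r → r ≟ 0 ⊎-dec r ≟ 1 ⊎-dec r ≟ 2) 3

*%3≡2⇒3∣+ : ∀ a b → (a * b) % 3 ≡ 2 → 3 ∣ a + b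
*%3≡2⇒3∣+ a b ab≡2 = m%n≡0⇒n∣m (a + b) 3 (begin
  (a + b) % 3         ≡⟨ %-distribˡ-+ a b 3 ⟩
  (a % 3 + b % 3) % 3 ≡⟨ residues (m%n<n b 3) (trans (sym (%-distribˡ-* a b 3)) ab≡2) ⟩
  0                   ∎)
  where
  open ≡-Reasoning
  residues : ∀ {s} → s < 3 → (a % 3 * s) % 3 ≡ 2 → (a % 3 + s) % 3 ≡ 0
  residues = ∀-residue (λ r → allUpTo? (λ s → ((r * s) % 3 ≟ 2) →-dec ((r + s) % 3 ≟ 0)) 3) 3 a

^3%3≡%3 : ∀ a → (a ^ 3) % 3 ≡ a % 3
^3%3≡%3 a = trans (%-distribˡ-^ a 3 3) (∀-residue (λ r → (r ^ 3) % 3 ≟ r) 3 a)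

^odd%3≡%3 : ∀ a k → k % 2 ≡ 1 → (a ^ k) % 3 ≡ a % 3
^odd%3≡%3 a k k%2≡1 = begin
  (a ^ k) % 3                   ≡⟨ cong (λ k → (a ^ k) % 3) (m≡m%n+[m/n]*n k 2) ⟩
  (a ^ (k % 2 + k / 2 * 2)) % 3 ≡⟨ cong (λ r → (a ^ (r + k / 2 * 2)) % 3) k%2≡1 ⟩
  (a ^ (1 + k / 2 * 2)) % 3     ≡⟨ ^[1+j*2]%3≡%3 (k / 2) ⟩
  a % 3                         ∎
  where
  open ≡-Reasoning
  ^[1+j*2]%3≡%3 : ∀ j → (a ^ (1 + j * 2)) % 3 ≡ a % 3
  ^[1+j*2]%3≡%3 zero    = cong (_% 3) (*-identityʳ a)
  ^[1+j*2]%3≡%3 (suc j) = begin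
    (a ^ (2 + (1 + j * 2))) % 3             ≡⟨ cong (_% 3) (^-distribˡ-+-* a 2 (1 + j * 2)) ⟩
    (a ^ 2 * a ^ (1 + j * 2)) % 3           ≡⟨ %-distribˡ-* (a ^ 2) _ 3 ⟩
    (a ^ 2 % 3 * (a ^ (1 + j * 2) % 3)) % 3 ≡⟨ cong (λ x → (a ^ 2 % 3 * x) % 3) (^[1+j*2]%3≡%3 j) ⟩
    (a ^ 2 % 3 * (a % 3)) % 3               ≡⟨ %-distribˡ-* (a ^ 2) a 3 ⟨
    (a ^ 2 * a) % 3                         ≡⟨ cong (_% 3) (*-comm (a ^ 2) a) ⟩
    (a ^ 3) % 3                             ≡⟨ ^3%3≡%3 a ⟩
    a % 3                                   ∎

¬3∣⇒^2%3≡1 : ¬ 3 ∣ a → (a ^ 2) % 3 ≡ 1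
¬3∣⇒^2%3≡1 {a} 3∤a = trans (%-distribˡ-^ a 2 3)
  (∀-residue (λ r → ¬? (r ≟ 0) →-dec ((r ^ 2) % 3 ≟ 1)) 3 a (3∤a ∘ m%n≡0⇒n∣m a 3))

¬2∣⇒^2%4≡1 : ¬ 2 ∣ a → (a ^ 2) % 4 ≡ 1
¬2∣⇒^2%4≡1 {a} 2∤a = trans (%-distribˡ-^ a 2 4)
  (∀-residue (λ r → ¬? (r % 2 ≟ 0) →-dec ((r ^ 2) % 4 ≟ 1)) 4 a
    (2∤a ∘ m%n≡0⇒n∣m a 2 ∘ trans (sym (m∣n⇒o%n%m≡o%m 2 4 a (divides 2 refl)))))

%4≡1∧%3≡1⇒%12≡1 : ∀ a → a % 4 ≡ 1 → a % 3 ≡ 1 → a % 12 ≡ 1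
%4≡1∧%3≡1⇒%12≡1 a a%4≡1 a%3≡1 =
  ∀-residue (λ r → (r % 4 ≟ 1) →-dec (r % 3 ≟ 1) →-dec (r ≟ 1)) 12 a
    (trans (m∣n⇒o%n%m≡o%m 4 12 a (divides 3 refl)) a%4≡1)
    (trans (m∣n⇒o%n%m≡o%m 3 12 a (divides 4 refl)) a%3≡1)

%4≡1∧9∣⇒%36≡9 : ∀ a → a % 4 ≡ 1 → 9 ∣ a → a % 36 ≡ 9
%4≡1∧9∣⇒%36≡9 a a%4≡1 9∣a =
  ∀-residue (λ r → (r % 4 ≟ 1) →-dec (r % 9 ≟ 0) →-dec (r ≟ 9)) 36 a
    (trans (m∣n⇒o%n%m≡o%m 4 36 a (divides 9 refl)) a%4≡1)
    (trans (m∣n⇒o%n%m≡o%m 9 36 a (divides 4 refl)) (n∣m⇒m%n≡0 a 9 9∣a))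

perfect⇒%3≢2 : ∀ n → Perfect n → n % 3 ≢ 2
perfect⇒%3≢2 n (0<n , σn≡2n) n%3≡2 = 0≢1+n (begin
  0               ≡⟨ n∣m⇒m%n≡0 (4 * n) 3 3∣4n ⟨
  (n + 3 * n) % 3 ≡⟨ %-remove-+ʳ n (m∣m*n n) ⟩
  n % 3           ≡⟨ n%3≡2 ⟩
  2               ∎)
  where
  open ≡-Reasoning
  instance _ = >-nonZero 0<n
  3∣pair : d ∣ n → 3 ∣ d + codivisor n d
  3∣pair {d} d∣n = *%3≡2⇒3∣+ d _ (trans (cong (_% 3) (*-codivisor d∣n)) n%3≡2)
  3∣4n : 3 ∣ 4 * n
  3∣4n = subst (3 ∣_) (trans (sum-divisor-pairs n) (trans (cong₂ _+_ σn≡2n σn≡2n) (sym (*-distribʳ-+ n 2 2))))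
    (∣-sum (All.map⁺ (All.tabulate (3∣pair ∘ ∈-divisors⁻))))

prime∣^⇒∣ : ∀ {p} k → Prime p → p ∣ a ^ k → p ∣ a
prime∣^⇒∣ zero    p-prime p∣1 = contradiction (subst Prime (∣1⇒≡1 p∣1) p-prime) ¬prime[1]
prime∣^⇒∣ {a} (suc k) p-prime p∣a^k+1 with euclidsLemma a (a ^ k) p-prime p∣a^k+1
... | inj₁ p∣a   = p∣a
... | inj₂ p∣a^k = prime∣^⇒∣ k p-prime p∣a^k

∣⇒∣*^2 : ∀ A {M} → d ∣ M → d ∣ A * M ^ 2
∣⇒∣*^2 A {M} d∣M = ∣-trans d∣M (∣-trans (m∣m*n (M * 1)) (n∣m*n A))

prime-∣*^2 : ∀ {p} A M → Prime p → ¬ p ∣ A → p ∣ A * M ^ 2 → p ∣ M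
prime-∣*^2 A M p-prime p∤A p∣AM² with euclidsLemma A (M ^ 2) p-prime p∣AM²
... | inj₁ p∣A  = contradiction p∣A p∤A
... | inj₂ p∣M² = prime∣^⇒∣ 2 p-prime p∣M²

^2-pres-∣ : d ∣ a → d ^ 2 ∣ a ^ 2
^2-pres-∣ d∣a = *-pres-∣ d∣a (*-pres-∣ d∣a ∣-refl)

prime[3] : Prime 3
prime[3] = toWitness {a? = prime? 3} _

prime%4≡1⇒3∤ : ∀ {p} → Prime p → p % 4 ≡ 1 → ¬ 3 ∣ p
prime%4≡1⇒3∤ p-prime p%4≡1 3∣p with prime⇒irreducible p-prime 3∣p | p%4≡1
... | inj₂ refl | ()

theorem1 : (n π α M : ℕ) → Perfect n → n % 2 ≡ 1 → n ≡ π ^ α * M ^ 2 → Prime π → 0 < α → 0 < M → gcd π M ≡ 1 → π % 4 ≡ 1 → α % 4 ≡ 1 →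
    (n % 36 ≡ 9) ⊎ ((n % 12 ≡ 1) × (π % 12 ≡ 1))
theorem1 n π α M perfect n-odd refl π-prime _ _ _ π%4≡1 α%4≡1 = by-residue-mod-3 (%3-cases n)
  where
  %≡1⇒∤M : ∀ {d} .{{_ : NonZero d}} → n % d ≡ 1 → ¬ d ∣ M
  %≡1⇒∤M n%d≡1 d∣M = 0≢1+n (trans (sym (n∣m⇒m%n≡0 n _ (∣⇒∣*^2 (π ^ α) d∣M))) n%d≡1)
  n%4≡1 : n % 4 ≡ 1
  n%4≡1 = trans (n%o≡1⇒[m*n]%o≡m%o (π ^ α) (M ^ 2) 4 (¬2∣⇒^2%4≡1 (%≡1⇒∤M n-odd)))
                (m%o≡1⇒m^n%o≡1 π α 4 π%4≡1)
  by-residue-mod-3 : n % 3 ≡ 0 ⊎ n % 3 ≡ 1 ⊎ n % 3 ≡ 2 → (n % 36 ≡ 9) ⊎ ((n % 12 ≡ 1) × (π % 12 ≡ 1))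
  by-residue-mod-3 (inj₁ n%3≡0) = inj₁ (%4≡1∧9∣⇒%36≡9 n n%4≡1 (∣-trans (^2-pres-∣ 3∣M) (n∣m*n (π ^ α))))
    where
    3∣M : 3 ∣ M
    3∣M = prime-∣*^2 (π ^ α) M prime[3] (prime%4≡1⇒3∤ π-prime π%4≡1 ∘ prime∣^⇒∣ α prime[3])
                     (m%n≡0⇒n∣m n 3 n%3≡0)
  by-residue-mod-3 (inj₂ (inj₁ n%3≡1)) = inj₂ (%4≡1∧%3≡1⇒%12≡1 n n%4≡1 n%3≡1 , %4≡1∧%3≡1⇒%12≡1 π π%4≡1 π%3≡1)
    where
    α%2≡1 : α % 2 ≡ 1
    α%2≡1 = trans (sym (m∣n⇒o%n%m≡o%m 2 4 α (divides 2 refl))) (cong (_% 2) α%4≡1)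
    π%3≡1 : π % 3 ≡ 1
    π%3≡1 = begin
      π % 3       ≡⟨ ^odd%3≡%3 π α α%2≡1 ⟨
      π ^ α % 3   ≡⟨ n%o≡1⇒[m*n]%o≡m%o (π ^ α) (M ^ 2) 3 (¬3∣⇒^2%3≡1 (%≡1⇒∤M n%3≡1)) ⟨
      n % 3       ≡⟨ n%3≡1 ⟩
      1           ∎
      where open ≡-Reasoning
  by-residue-mod-3 (inj₂ (inj₂ n%3≡2)) = contradiction n%3≡2 (perfect⇒%3≢2 n perfect)
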